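{- Let $\tau$ be a permutation of length at least $3$ which is not equal to the reverse identity. Then for every $n\ge1$, the number of permutations of length $n$ sorted to the reverse identity $n(n-1)\cdots 1$ by $s_{\{231,\tau\}}$ is $C_{n-1}$, the $(n-1)$st Catalan number. Moreover, the permutations of length $n$ sorted to the reverse identity are exactly those of the form $1\rho$ (the entry $1$ followed by $\rho$), where $\rho$ is a permutation of $\{2,\dots,n\}$ avoiding $213$.
   Context: A sequence of distinct integers contains a permutation $\tau$ if some subsequence is order-isomorphic to $\tau$; otherwise it avoids $\tau$. For a set $T$ of permutations, the map $s_T$ is defined by: read the input permutation left to right with an initially empty stack and output; at each step, if there is a next input element and pushing it keeps the stack contents, read from top to bottom, $T$-avoiding, push it; otherwise pop the top of the stack and append it to the output; stop when input and stack are empty; the output is $s_T(\pi)$. $C_m=\frac{1}{m+1}\binom{2m}{m}$. -}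

module Defs where

open import Data.Nat using (ℕ; zero; suc; _<_; _/_)
open import Data.Nat.Combinatorics using (_C_)
open import Data.List using (List; []; _∷_; map; upTo; downFrom)
open import Data.List.Relation.Binary.Sublist.Propositional using (_⊆_)
open import Data.List.Relation.Binary.Pointwise using (Pointwise)
open import Data.List.Relation.Binary.Permutation.Propositional using (_↭_)
open import Data.List.Relation.Unary.All using (All)
open import Data.Product using (Σ; ∃; _×_)
open import Data.Empty using (⊥)
open import Relation.Nullary using (¬_)
open import Function.Bundles using (_⇔_)

catalan : ℕ → ℕ
catalan m = ((m Data.Nat.+ m) C m) / suc m

identity : ℕ → List ℕ
identity n = map suc (upTo n)

revIdentity : ℕ → List ℕ
revIdentity n = map suc (downFrom n)

IsPerm : ℕ → List ℕ → Set
IsPerm n π = π ↭ identity n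

OrderIso : List ℕ → List ℕ → Set
OrderIso [] [] = Data.Unit.⊤ where import Data.Unit
OrderIso [] (_ ∷ _) = ⊥
OrderIso (_ ∷ _) [] = ⊥
OrderIso (a ∷ σ) (b ∷ τ) =
  Pointwise (λ x y → ((a < x) ⇔ (b < y)) × ((x < a) ⇔ (y < b))) σ τ × OrderIso σ τ

Contains : List ℕ → List ℕ → Set
Contains π τ = ∃ λ σ → σ ⊆ π × OrderIso σ τ

Avoids : List ℕ → List ℕ → Set
Avoids π τ = ¬ Contains π τ

AvoidsAll : List (List ℕ) → List ℕ → Set
AvoidsAll T st = All (Avoids st) T

CanPush : List (List ℕ) → List ℕ → List ℕ → Set
CanPush T [] stk = ⊥
CanPush T (x ∷ _) stk = AvoidsAll T (x ∷ stk)

-- Run T inp stk out : starting from remaining input inp and stack stk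
-- (listed top to bottom), the algorithm s_T terminates and the output it
-- appends from this point on is out.
data Run (T : List (List ℕ)) : List ℕ → List ℕ → List ℕ → Set where
  done : Run T [] [] []
  push : ∀ {x inp stk out} → AvoidsAll T (x ∷ stk) →
         Run T inp (x ∷ stk) out → Run T (x ∷ inp) stk out
  pop  : ∀ {inp y stk out} → ¬ CanPush T inp (y ∷ stk) →
         Run T inp stk out → Run T inp (y ∷ stk) (y ∷ out)

SortsTo : List (List ℕ) → List ℕ → List ℕ → Set
SortsTo T π σ = Run T π [] σ

p231 p213 : List ℕ
p231 = 2 ∷ 3 ∷ 1 ∷ []
p213 = 2 ∷ 1 ∷ 3 ∷ []

-- Sorting to n⋯1 forces 1 to come first: the first entry pushed stays at the
-- bottom of the stack and is output last. Above that 1, pushing x onto a larger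
-- entry s would create the pattern 231 (x, s, 1), while a decreasing stack avoids
-- 231 and, as τ ≠ n⋯1, also τ. So the machine pushes exactly when the next entry
-- exceeds the top of the stack, and its output is n⋯1 exactly when the rest of
-- the input avoids 213.
-- For the count, reading the push/pop word of such a run backwards from the
-- output n⋯1 recovers the input, and every admissible word arises this way; these
-- words are counted by ballot numbers, which gives (2m C m)/(m+1) for m = n − 1.
module Submission where

open import Defs
open import Data.Bool using (Bool; true; false)
open import Data.Empty using (⊥; ⊥-elim)
open import Data.List using (List; []; _∷_; length; map; _++_; upTo; replicate)
open import Data.List.Properties using (∷-injective; ∷-injectiveʳ; ∷ʳ-injective; length-map; length-++; length-upTo; ++-identityʳ; reverse-upTo)
open import Data.List.Membership.Propositional using (_∈_)
open import Data.List.Membership.Propositional.Properties using (∈-++⁺ˡ; ∈-++⁺ʳ; ∈-++⁻; ∈-map⁺; ∈-map⁻)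
open import Data.List.Relation.Unary.Any using (here; there)
open import Data.List.Relation.Unary.All as All using (All; []; _∷_)
import Data.List.Relation.Unary.All.Properties as All
open import Data.List.Relation.Unary.AllPairs as AllPairs using (AllPairs; []; _∷_)
open import Data.List.Relation.Unary.Linked as Linked using (Linked)
open import Data.List.Relation.Unary.Linked.Properties using (AllPairs⇒Linked)
open import Data.List.Relation.Unary.Sorted.TotalOrder.Properties using (↗↭↗⇒≋)
open import Data.List.Relation.Unary.Unique.Propositional using (Unique)
import Data.List.Relation.Unary.Unique.Propositional.Properties as Unique
open import Data.List.Relation.Binary.Sublist.Propositional using (_⊆_; []; _∷_; _∷ʳ_; from∈; to∈)
open import Data.List.Relation.Binary.Sublist.Propositional.Properties using (All-resp-⊆)
open import Data.List.Relation.Binary.Sublist.Heterogeneous.Properties using (length-mono-≤; ∷ˡ⁻)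
open import Data.List.Relation.Binary.Pointwise using (Pointwise; []; _∷_; Pointwise-≡⇒≡)
open import Data.List.Relation.Binary.Permutation.Propositional using (_↭_; ↭-refl; ↭-sym; ↭-trans; ↭-prep; ↭⇒↭ₛ)
open import Data.List.Relation.Binary.Permutation.Propositional.Properties using (shift; ∈-resp-↭; ↭-length; ↭-reverse; map⁺; All-resp-↭)
import Data.List.Relation.Binary.Permutation.Setoid.Properties as PermutationSetoid
open import Data.Nat using (ℕ; zero; suc; _+_; _*_; _∸_; _≤_; _<_; _>_; _≥_; z≤n; s≤s)
open import Data.Nat.Properties
open import Data.Nat.Combinatorics using (_C_; nCk≡nC[n∸k]; nCk+nC[k+1]≡[n+1]C[k+1]; nC1≡n)
open import Data.Nat.DivMod using (_/_; m*n/n≡m)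
open import Data.Nat.Tactic.RingSolver using (solve-∀)
open import Data.Product using (∃; _×_; _,_; proj₁; proj₂; uncurry)
open import Data.Sum using (inj₁; inj₂)
open import Data.Unit using (tt)
open import Function.Bundles using (_⇔_; mk⇔; Equivalence)
open import Relation.Binary.Definitions using (tri<; tri≈; tri>)
open import Relation.Binary.Properties.TotalOrder ≤-totalOrder using (≥-totalOrder)
open import Relation.Binary.PropositionalEquality using (_≡_; _≢_; refl; sym; trans; cong; cong₂; subst; setoid; module ≡-Reasoning)
open import Relation.Nullary using (¬_)

Decreasing : List ℕ → Set
Decreasing = AllPairs _>_

OrderIso-length : ∀ σ τ → OrderIso σ τ → length σ ≡ length τ
OrderIso-length []      []      _       = refl
OrderIso-length (_ ∷ σ) (_ ∷ τ) (_ , o) = cong suc (OrderIso-length σ τ o)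

shorter⇒Avoids : ∀ π τ → length π < length τ → Avoids π τ
shorter⇒Avoids π τ |π|<|τ| (σ , σ⊆π , σ≅τ) =
  <⇒≱ |π|<|τ| (subst (_≤ length π) (OrderIso-length σ τ σ≅τ) (length-mono-≤ σ⊆π))

AllPairs-resp-⊆ : ∀ {A : Set} {R : A → A → Set} {σ π} → σ ⊆ π → AllPairs R π → AllPairs R σ
AllPairs-resp-⊆ []           []      = []
AllPairs-resp-⊆ (_ ∷ʳ σ⊆π)   (_ ∷ r) = AllPairs-resp-⊆ σ⊆π r
AllPairs-resp-⊆ (refl ∷ σ⊆π) (h ∷ r) = All-resp-⊆ σ⊆π h ∷ AllPairs-resp-⊆ σ⊆π r

OrderIso-Decreasing : ∀ σ τ → OrderIso σ τ → Decreasing σ → Decreasing τ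
OrderIso-Decreasing []      []      _           _       = []
OrderIso-Decreasing (a ∷ σ) (b ∷ τ) (rel , σ≅τ) (h ∷ d) = below rel h ∷ OrderIso-Decreasing σ τ σ≅τ d
  where
  below : ∀ {xs ys} → Pointwise (λ x y → ((a < x) ⇔ (b < y)) × ((x < a) ⇔ (y < b))) xs ys →
          All (_< a) xs → All (_< b) ys
  below []         []         = []
  below (r ∷ rel′) (x<a ∷ h′) = Equivalence.to (proj₂ r) x<a ∷ below rel′ h′

Contains-Decreasing : ∀ {π τ} → Decreasing π → Contains π τ → Decreasing τ
Contains-Decreasing {τ = τ} d (σ , σ⊆π , σ≅τ) = OrderIso-Decreasing σ τ σ≅τ (AllPairs-resp-⊆ σ⊆π d)

Decreasing-↭⇒≡ : ∀ {xs ys} → Decreasing xs → Decreasing ys → xs ↭ ys → xs ≡ ys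
Decreasing-↭⇒≡ xs↘ ys↘ xs↭ys =
  Pointwise-≡⇒≡ (↗↭↗⇒≋ ≥-totalOrder (sorted xs↘) (sorted ys↘) (↭⇒↭ₛ xs↭ys))
  where
  sorted : ∀ {zs} → Decreasing zs → Linked _≥_ zs
  sorted d = Linked.map <⇒≤ (AllPairs⇒Linked d)

Unique-resp-↭ : ∀ {xs ys : List ℕ} → xs ↭ ys → Unique xs → Unique ys
Unique-resp-↭ xs↭ys = PermutationSetoid.Unique-resp-↭ (setoid ℕ) (↭⇒↭ₛ xs↭ys)

Unique-map⁺-injectiveOn : ∀ {A B : Set} (f : A → B) {xs : List A} →
              (∀ {a b} → a ∈ xs → b ∈ xs → f a ≡ f b → a ≡ b) → Unique xs → Unique (map f xs)
Unique-map⁺-injectiveOn f {[]}     inj []      = []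
Unique-map⁺-injectiveOn f {x ∷ xs} inj (h ∷ u) =
  All.map⁺ (All.tabulate (λ y∈xs fx≡fy → All.lookup h y∈xs (inj (here refl) (there y∈xs) fx≡fy))) ∷
  Unique-map⁺-injectiveOn f (λ a∈xs b∈xs → inj (there a∈xs) (there b∈xs)) u

revIdentity-≤ : ∀ n → All (_≤ n) (revIdentity n)
revIdentity-≤ zero    = []
revIdentity-≤ (suc n) = ≤-refl ∷ All.map m≤n⇒m≤1+n (revIdentity-≤ n)

revIdentity-decreasing : ∀ n → Decreasing (revIdentity n)
revIdentity-decreasing zero    = []
revIdentity-decreasing (suc n) = All.map s≤s (revIdentity-≤ n) ∷ revIdentity-decreasing n

revIdentity↭identity : ∀ n → revIdentity n ↭ identity n
revIdentity↭identity n =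
  subst (λ l → map suc l ↭ identity n) (reverse-upTo n) (map⁺ suc (↭-reverse (upTo n)))

revIdentity-endsWith-1 : ∀ m → ∃ λ pre → revIdentity (suc m) ≡ pre ++ 1 ∷ []
revIdentity-endsWith-1 zero = [] , refl
revIdentity-endsWith-1 (suc m) with revIdentity-endsWith-1 m
... | pre , eq = suc (suc m) ∷ pre , cong (suc (suc m) ∷_) eq

identity-positive : ∀ n → All (1 ≤_) (identity n)
identity-positive n = All.map⁺ (All.universal (λ _ → s≤s z≤n) (upTo n))

identity-unique : ∀ n → Unique (identity n)
identity-unique n = Unique.map⁺ suc-injective (Unique.upTo⁺ n)

length-identity : ∀ n → length (identity n) ≡ n
length-identity n = trans (length-map suc (upTo n)) (length-upTo n)

private
  ⇔-holds : ∀ {A B : Set} → A → B → A ⇔ B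
  ⇔-holds a b = mk⇔ (λ _ → b) (λ _ → a)

  ⇔-fails : ∀ {A B : Set} → ¬ A → ¬ B → A ⇔ B
  ⇔-fails ¬a ¬b = mk⇔ (λ a → ⊥-elim (¬a a)) (λ b → ⊥-elim (¬b b))

  1<2 : 1 < 2
  1<2 = n<1+n 1

  2<3 : 2 < 3
  2<3 = n<1+n 2

  1<3 : 1 < 3
  1<3 = <-trans 1<2 2<3

OrderIso-231 : ∀ {x y z} → z < x → x < y → OrderIso (x ∷ y ∷ z ∷ []) p231
OrderIso-231 z<x x<y =
  ((⇔-holds x<y 2<3 , ⇔-fails (<-asym x<y) (<-asym 2<3)) ∷
   (⇔-fails (<-asym z<x) (<-asym 1<2) , ⇔-holds z<x 1<2) ∷ []) ,
  ((⇔-fails (<-asym z<y) (<-asym 1<3) , ⇔-holds z<y 1<3) ∷ []) ,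
  ([] , tt)
  where z<y = <-trans z<x x<y

OrderIso-213 : ∀ {x y z} → y < x → x < z → OrderIso (x ∷ y ∷ z ∷ []) p213
OrderIso-213 y<x x<z =
  ((⇔-fails (<-asym y<x) (<-asym 1<2) , ⇔-holds y<x 1<2) ∷
   (⇔-holds x<z 2<3 , ⇔-fails (<-asym x<z) (<-asym 2<3)) ∷ []) ,
  ((⇔-holds y<z 1<3 , ⇔-fails (<-asym y<z) (<-asym 1<3)) ∷ []) ,
  ([] , tt)
  where y<z = <-trans y<x x<z

OrderIso-213⁻ : ∀ σ → OrderIso σ p213 → ∃ λ x → ∃ λ y → ∃ λ z → σ ≡ x ∷ y ∷ z ∷ [] × y < x × x < z
OrderIso-213⁻ (x ∷ y ∷ z ∷ []) ((y~1 ∷ z~3 ∷ []) , _) =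
  x , y , z , refl , Equivalence.from (proj₂ y~1) 1<2 , Equivalence.from (proj₁ z~3) 2<3

module _ {T : List (List ℕ)} where

  Run-↭ : ∀ {inp stk out} → Run T inp stk out → out ↭ inp ++ stk
  Run-↭ done                          = ↭-refl
  Run-↭ (push {x} {inp} {stk} _ run) = ↭-trans (Run-↭ run) (shift x inp stk)
  Run-↭ (pop {inp} {y} {stk} _ run)  = ↭-trans (↭-prep y (Run-↭ run)) (↭-sym (shift y inp stk))

  Run-stack⊆output : ∀ {inp stk out} → Run T inp stk out → stk ⊆ out
  Run-stack⊆output done         = []
  Run-stack⊆output (push _ run) = ∷ˡ⁻ (Run-stack⊆output run)
  Run-stack⊆output (pop _ run)  = refl ∷ Run-stack⊆output run

  sortsToRev⇒IsPerm : ∀ {n π} → SortsTo T π (revIdentity n) → IsPerm n π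
  sortsToRev⇒IsPerm {n} {π} run =
    ↭-trans (subst (_↭ revIdentity n) (++-identityʳ π) (↭-sym (Run-↭ run))) (revIdentity↭identity n)

  Run-finished : ∀ {out} → Run T [] [] out → out ≡ []
  Run-finished done = refl

  Run-popAll : ∀ stk → Run T [] stk stk
  Run-popAll []        = done
  Run-popAll (y ∷ stk) = pop (λ ()) (Run-popAll stk)

  -- Either q is pushed above p, and so output before it, or p is popped while
  -- r is unread, and so output before r.
  Run-decreasing-stack⇒¬213 : ∀ {inp stk out p q r} → Run T inp stk out → Decreasing out →
                              p ∈ stk → (q ∷ r ∷ []) ⊆ inp → q < p → p < r → ⊥
  Run-decreasing-stack⇒¬213 (push {x} _ run) out↘ p∈stk (.x ∷ʳ qr⊆inp) =
    Run-decreasing-stack⇒¬213 run out↘ (there p∈stk) qr⊆inp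
  Run-decreasing-stack⇒¬213 (push _ run) out↘ p∈stk (refl ∷ _) q<p _ =
    <-asym q<p (All.lookup (AllPairs.head (AllPairs-resp-⊆ (Run-stack⊆output run) out↘)) p∈stk)
  Run-decreasing-stack⇒¬213 (pop _ run) (h ∷ _) (here refl) qr⊆inp _ p<r =
    <-asym p<r (All.lookup h (∈-resp-↭ (↭-sym (Run-↭ run)) (∈-++⁺ˡ (to∈ (∷ˡ⁻ qr⊆inp)))))
  Run-decreasing-stack⇒¬213 (pop _ run) (_ ∷ out↘) (there p∈stk) =
    Run-decreasing-stack⇒¬213 run out↘ p∈stk

  Run-decreasing⇒¬213 : ∀ {inp stk out p q r} → Run T inp stk out → Decreasing out →
                        (p ∷ q ∷ r ∷ []) ⊆ inp → q < p → p < r → ⊥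
  Run-decreasing⇒¬213 (push {x} _ run) out↘ (.x ∷ʳ pqr⊆inp) = Run-decreasing⇒¬213 run out↘ pqr⊆inp
  Run-decreasing⇒¬213 (push _ run) out↘ (refl ∷ qr⊆inp) = Run-decreasing-stack⇒¬213 run out↘ (here refl) qr⊆inp
  Run-decreasing⇒¬213 (pop _ run) (_ ∷ out↘) = Run-decreasing⇒¬213 run out↘

  Run-decreasing⇒Avoids213 : ∀ {inp stk out} → Run T inp stk out → Decreasing out → Avoids inp p213
  Run-decreasing⇒Avoids213 run out↘ (σ , σ⊆inp , σ≅213) with OrderIso-213⁻ σ σ≅213
  ... | _ , _ , _ , refl , q<p , p<r = Run-decreasing⇒¬213 run out↘ σ⊆inp q<p p<r

-- A stack word with u entries still to read and h entries on the stack above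
-- its bottom: true pushes, false pops; it reads everything and ends with only
-- the bottom entry left.
data Admissible : ℕ → ℕ → List Bool → Set where
  end  : Admissible 0 0 []
  up   : ∀ {u h w} → Admissible u (suc h) w → Admissible (suc u) h (true ∷ w)
  down : ∀ {u h w} → Admissible u h w → Admissible u (suc h) (false ∷ w)

admissibleWords : ℕ → ℕ → List (List Bool)
admissibleWords zero    h       = replicate h false ∷ []
admissibleWords (suc u) zero    = map (true ∷_) (admissibleWords u 1)
admissibleWords (suc u) (suc h) = map (true ∷_) (admissibleWords u (suc (suc h))) ++
                                  map (false ∷_) (admissibleWords (suc u) h)

Admissible-pops : ∀ h → Admissible 0 h (replicate h false)
Admissible-pops zero    = end
Admissible-pops (suc h) = down (Admissible-pops h)

∈-admissibleWords⁻ : ∀ u h {w} → w ∈ admissibleWords u h → Admissible u h w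
∈-admissibleWords⁻ zero h (here refl) = Admissible-pops h
∈-admissibleWords⁻ (suc u) zero w∈ with ∈-map⁻ (true ∷_) w∈
... | _ , w′∈ , refl = up (∈-admissibleWords⁻ u 1 w′∈)
∈-admissibleWords⁻ (suc u) (suc h) w∈ with ∈-++⁻ (map (true ∷_) (admissibleWords u (suc (suc h)))) w∈
... | inj₁ w∈ups with ∈-map⁻ (true ∷_) w∈ups
...   | _ , w′∈ , refl = up (∈-admissibleWords⁻ u (suc (suc h)) w′∈)
∈-admissibleWords⁻ (suc u) (suc h) w∈ | inj₂ w∈downs with ∈-map⁻ (false ∷_) w∈downs
...   | _ , w′∈ , refl = down (∈-admissibleWords⁻ (suc u) h w′∈)

∈-admissibleWords⁺ : ∀ {u h w} → Admissible u h w → w ∈ admissibleWords u h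
∈-admissibleWords⁺ end = here refl
∈-admissibleWords⁺ (up {h = zero} a)  = ∈-map⁺ _ (∈-admissibleWords⁺ a)
∈-admissibleWords⁺ (up {h = suc h} a) = ∈-++⁺ˡ (∈-map⁺ _ (∈-admissibleWords⁺ a))
∈-admissibleWords⁺ (down {u = zero} a) with ∈-admissibleWords⁺ a
... | here refl = here refl
∈-admissibleWords⁺ (down {u = suc u} {h} a) =
  ∈-++⁺ʳ (map (true ∷_) (admissibleWords u (suc (suc h)))) (∈-map⁺ _ (∈-admissibleWords⁺ a))

admissibleWords-unique : ∀ u h → Unique (admissibleWords u h)
admissibleWords-unique zero    h       = [] ∷ []
admissibleWords-unique (suc u) zero    = Unique.map⁺ ∷-injectiveʳ (admissibleWords-unique u 1)
admissibleWords-unique (suc u) (suc h) =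
  Unique.++⁺ (Unique.map⁺ ∷-injectiveʳ (admissibleWords-unique u (suc (suc h))))
             (Unique.map⁺ ∷-injectiveʳ (admissibleWords-unique (suc u) h))
             up≢down
  where
  up≢down : ∀ {w} → w ∈ map (true ∷_) (admissibleWords u (suc (suc h))) ×
                    w ∈ map (false ∷_) (admissibleWords (suc u) h) → ⊥
  up≢down (w∈ups , w∈downs) with ∈-map⁻ (true ∷_) w∈ups | ∈-map⁻ (false ∷_) w∈downs
  ... | _ , _ , refl | _ , _ , ()

-- n C (k ∸ 1), except that it is 0 rather than n C 0 for k = 0.
prevBinomial : ℕ → ℕ → ℕ
prevBinomial n zero    = 0
prevBinomial n (suc k) = n C k

C-pascal : ∀ n k → suc n C k ≡ prevBinomial n k + n C k
C-pascal n zero    = refl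
C-pascal n (suc k) = sym (nCk+nC[k+1]≡[n+1]C[k+1] n k)

C-sym : ∀ {n} k l → n ≡ k + l → n C k ≡ n C l
C-sym {n} k l refl = trans (nCk≡nC[n∸k] (m≤m+n k l)) (cong (n C_) (m+n∸m≡n k l))

C-absorption : ∀ n k → suc k * (suc n C suc k) ≡ suc n * (n C k)
C-absorption zero    zero    = refl
C-absorption zero    (suc k) = *-zeroʳ (suc (suc k))
C-absorption (suc n) zero    = trans (*-identityˡ _) (trans (nC1≡n (suc (suc n))) (sym (*-identityʳ _)))
C-absorption (suc n) (suc k) = begin
  suc (suc k) * (suc (suc n) C suc (suc k))           ≡⟨ cong (suc (suc k) *_) (C-pascal (suc n) (suc (suc k))) ⟩
  suc (suc k) * (a + b)                               ≡⟨ split a b k ⟩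
  a + suc k * a + suc (suc k) * b                     ≡⟨ cong₂ (λ x y → a + x + y) (C-absorption n k) (C-absorption n (suc k)) ⟩
  a + suc n * (n C k) + suc n * (n C suc k)           ≡⟨ join a (n C k) (n C suc k) n ⟩
  a + suc n * (n C k + n C suc k)                     ≡⟨ cong (λ x → a + suc n * x) (nCk+nC[k+1]≡[n+1]C[k+1] n k) ⟩
  a + suc n * a                                       ≡⟨⟩
  suc (suc n) * a                                     ∎
  where
  open ≡-Reasoning
  a = suc n C suc k
  b = suc n C suc (suc k)
  split : ∀ a b k → suc (suc k) * (a + b) ≡ a + suc k * a + suc (suc k) * b
  split = solve-∀
  join : ∀ a c d n → a + suc n * c + suc n * d ≡ a + suc n * (c + d)
  join = solve-∀

length-admissibleWords : ∀ u h {n} → n ≡ u + u + h →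
                         length (admissibleWords u h) + prevBinomial n u ≡ n C u
length-admissibleWords zero    h       _  = refl
length-admissibleWords (suc u) zero    {suc M} eq = begin
  length (map (true ∷_) ups) + suc M C u    ≡⟨ cong₂ _+_ (length-map _ ups) (C-pascal M u) ⟩
  length ups + (prevBinomial M u + M C u)    ≡⟨ +-assoc (length ups) _ _ ⟨
  length ups + prevBinomial M u + M C u      ≡⟨ cong (_+ M C u) (length-admissibleWords u 1 (trans M≡ (ups-index u))) ⟩
  M C u + M C u                              ≡⟨ cong (M C u +_) (C-sym (suc u) u (trans M≡ (middle-index u))) ⟨
  M C u + M C suc u                          ≡⟨ nCk+nC[k+1]≡[n+1]C[k+1] M u ⟩
  suc M C suc u                              ∎
  where
  open ≡-Reasoning
  ups = admissibleWords u 1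
  M≡ : M ≡ u + suc u + 0
  M≡ = suc-injective eq
  ups-index : ∀ u → u + suc u + 0 ≡ u + u + 1
  ups-index = solve-∀
  middle-index : ∀ u → u + suc u + 0 ≡ suc u + u
  middle-index = solve-∀
length-admissibleWords (suc u) (suc h) {suc M} eq = begin
  length (map (true ∷_) ups ++ map (false ∷_) downs) + suc M C u
    ≡⟨ cong₂ _+_ (trans (length-++ (map (true ∷_) ups)) (cong₂ _+_ (length-map _ ups) (length-map _ downs)))
                 (C-pascal M u) ⟩
  (length ups + length downs) + (prevBinomial M u + M C u)
    ≡⟨ interchange (length ups) (length downs) (prevBinomial M u) (M C u) ⟩
  (length ups + prevBinomial M u) + (length downs + M C u)
    ≡⟨ cong₂ _+_ (length-admissibleWords u (suc (suc h)) (trans M≡ (ups-index u h)))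
                 (length-admissibleWords (suc u) h M≡) ⟩
  M C u + M C suc u
    ≡⟨ nCk+nC[k+1]≡[n+1]C[k+1] M u ⟩
  suc M C suc u ∎
  where
  open ≡-Reasoning
  ups = admissibleWords u (suc (suc h))
  downs = admissibleWords (suc u) h
  M≡ : M ≡ suc u + suc u + h
  M≡ = suc-injective (trans eq (+-suc (suc u + suc u) h))
  ups-index : ∀ u h → suc u + suc u + h ≡ u + u + suc (suc h)
  ups-index = solve-∀
  interchange : ∀ a b c d → (a + b) + (c + d) ≡ (a + c) + (b + d)
  interchange = solve-∀

[m+1]·C[2m,m-1]≡m·C[2m,m] : ∀ m → suc m * prevBinomial (m + m) m ≡ m * ((m + m) C m)
[m+1]·C[2m,m-1]≡m·C[2m,m] zero    = refl
[m+1]·C[2m,m-1]≡m·C[2m,m] (suc j) = begin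
  suc (suc j) * (Q′ C j)           ≡⟨ cong (suc (suc j) *_) (C-sym j (suc (suc j)) (Q′-split j)) ⟩
  suc (suc j) * (Q′ C suc (suc j)) ≡⟨ C-absorption Q (suc j) ⟩
  suc Q * (Q C suc j)              ≡⟨ cong (suc Q *_) (C-sym (suc j) j (+-suc j j)) ⟩
  suc Q * (Q C j)                  ≡⟨ C-absorption Q j ⟨
  suc j * (Q′ C suc j)             ∎
  where
  open ≡-Reasoning
  Q = j + suc j
  Q′ = suc j + suc j
  Q′-split : ∀ j → suc j + suc j ≡ j + suc (suc j)
  Q′-split = solve-∀

catalan≡length-admissibleWords : ∀ m → catalan m ≡ length (admissibleWords m 0)
catalan≡length-admissibleWords m =
  trans (cong (_/ suc m) (sym N·[m+1]≡central)) (m*n/n≡m N (suc m))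
  where
  open ≡-Reasoning
  N = length (admissibleWords m 0)
  central = (m + m) C m
  before = prevBinomial (m + m) m
  N·[m+1]≡central : N * suc m ≡ central
  N·[m+1]≡central = +-cancelˡ-≡ (m * central) _ _ (begin
    m * central + N * suc m          ≡⟨ cong (_+ N * suc m) ([m+1]·C[2m,m-1]≡m·C[2m,m] m) ⟨
    suc m * before + N * suc m       ≡⟨ regroup before N m ⟩
    suc m * (N + before)             ≡⟨ cong (suc m *_) (length-admissibleWords m 0 (sym (+-identityʳ (m + m)))) ⟩
    suc m * central                  ≡⟨ +-comm central (m * central) ⟩
    m * central + central            ∎)
    where
    regroup : ∀ x c m → suc m * x + c * suc m ≡ suc m * (c + x)
    regroup = solve-∀

record Config : Set where
  constructor config
  field
    input   : List ℕ
    stack   : List ℕ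
    pending : ℕ

open Config

-- replay w is the configuration (input, stack above the bottom entry 1, k)
-- from which performing w outputs k ⋯ 1, read backwards from the final one:
-- undoing a pop puts k + 1 back on the stack, undoing a push moves the top
-- of the stack back to the input.
replayStep : Bool → Config → Config
replayStep false (config I S k)       = config I (suc k ∷ S) (suc k)
replayStep true  (config I [] k)      = config I [] k
replayStep true  (config I (s ∷ S) k) = config (s ∷ I) S k

replay : List Bool → Config
replay []      = config [] [] 1
replay (b ∷ w) = replayStep b (replay w)

sortedPermutations : ℕ → List (List ℕ)
sortedPermutations m = map (λ w → 1 ∷ input (replay w)) (admissibleWords m 0)

length-sortedPermutations : ∀ m → length (sortedPermutations m) ≡ catalan m
length-sortedPermutations m =
  trans (length-map _ (admissibleWords m 0)) (sym (catalan≡length-admissibleWords m))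

module SortBy231And (τ : List ℕ) (τ-perm : IsPerm (length τ) τ) (3≤|τ| : 3 ≤ length τ)
                    (τ≢rev : τ ≢ revIdentity (length τ)) where

  T : List (List ℕ)
  T = p231 ∷ τ ∷ []

  short⇒AvoidsAll : ∀ σ → length σ < 3 → AvoidsAll T σ
  short⇒AvoidsAll σ |σ|<3 = shorter⇒Avoids σ p231 |σ|<3 ∷ shorter⇒Avoids σ τ (<-≤-trans |σ|<3 3≤|τ|) ∷ []

  pushable₁ : ∀ {x} → AvoidsAll T (x ∷ [])
  pushable₁ = short⇒AvoidsAll (_ ∷ []) 1<3

  pushable₂ : ∀ {x y} → AvoidsAll T (x ∷ y ∷ [])
  pushable₂ = short⇒AvoidsAll (_ ∷ _ ∷ []) 2<3

  decreasing⇒AvoidsAll : ∀ σ → Decreasing σ → AvoidsAll T σ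
  decreasing⇒AvoidsAll σ σ↘ = (λ c → p231-not-decreasing (Contains-Decreasing σ↘ c)) ∷
                              (λ c → τ≢rev (Decreasing-↭⇒≡ (Contains-Decreasing σ↘ c)
                                              (revIdentity-decreasing _) τ↭rev)) ∷ []
    where
    p231-not-decreasing : ¬ Decreasing p231
    p231-not-decreasing ((2>3 ∷ _) ∷ _) = <-asym 2>3 2<3
    τ↭rev : τ ↭ revIdentity (length τ)
    τ↭rev = ↭-trans τ-perm (↭-sym (revIdentity↭identity _))

  contains231⇒¬AvoidsAll : ∀ {x y z σ} → (x ∷ y ∷ z ∷ []) ⊆ σ → z < x → x < y → ¬ AvoidsAll T σ
  contains231⇒¬AvoidsAll xyz⊆σ z<x x<y (avoids231 ∷ _) = avoids231 (_ , xyz⊆σ , OrderIso-231 z<x x<y)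

  Run-outputsBottomLast : ∀ S {b inp stk out} → Run T inp stk out → stk ≡ S ++ b ∷ [] →
                          ∃ λ pre → out ≡ pre ++ b ∷ []
  Run-outputsBottomLast []      done ()
  Run-outputsBottomLast (_ ∷ _) done ()
  Run-outputsBottomLast S       (push {x} _ run) eq = Run-outputsBottomLast (x ∷ S) run (cong (x ∷_) eq)
  Run-outputsBottomLast []      (pop {[]} _ run) refl = [] , cong (_ ∷_) (Run-finished run)
  Run-outputsBottomLast []      (pop {_ ∷ _} ¬pushable _) refl = ⊥-elim (¬pushable pushable₂)
  Run-outputsBottomLast (s ∷ S) (pop _ run) refl with Run-outputsBottomLast S run refl
  ... | pre , eq = s ∷ pre , cong (s ∷_) eq

  Run-rev⇒bottom≡1 : ∀ m {b inp} → Run T inp (b ∷ []) (revIdentity (suc m)) → b ≡ 1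
  Run-rev⇒bottom≡1 m run with Run-outputsBottomLast [] run refl | revIdentity-endsWith-1 m
  ... | pre , eq | pre′ , eq′ = proj₂ (∷ʳ-injective pre pre′ (trans (sym eq) eq′))

  sortsToRev⇒startsWith1 : ∀ m {π} → SortsTo T π (revIdentity (suc m)) →
                           ∃ λ ρ → π ≡ 1 ∷ ρ × Run T ρ (1 ∷ []) (revIdentity (suc m))
  sortsToRev⇒startsWith1 m {[]} run with Run-finished run
  ... | ()
  sortsToRev⇒startsWith1 m {a ∷ ρ} (push _ run) with Run-rev⇒bottom≡1 m run
  ... | refl = ρ , refl , run

  record Sortable (inp S : List ℕ) : Set where
    field
      stack↘          : Decreasing (S ++ 1 ∷ [])
      input>1         : All (1 <_) inp
      unique          : Unique (S ++ inp)
      stack-dominates : ∀ {y x z} → y ∈ S → (x ∷ z ∷ []) ⊆ inp → x < y → z < y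
      input-213-free  : ∀ {x y z} → (x ∷ y ∷ z ∷ []) ⊆ inp → y < x → z < x

  open Sortable

  Sortable-pushOnto1 : ∀ {x inp} → Sortable (x ∷ inp) [] → Sortable inp (x ∷ [])
  Sortable-pushOnto1 {x} inv = record
    { stack↘          = (All.head (input>1 inv) ∷ []) ∷ [] ∷ []
    ; input>1         = All.tail (input>1 inv)
    ; unique          = unique inv
    ; stack-dominates = λ { (here refl) x′z⊆inp → input-213-free inv (refl ∷ x′z⊆inp) }
    ; input-213-free  = λ xyz⊆inp → input-213-free inv (x ∷ʳ xyz⊆inp)
    }

  Sortable-pop : ∀ {x s inp S} → Sortable (x ∷ inp) (s ∷ S) → Sortable (x ∷ inp) S
  Sortable-pop inv = record
    { stack↘          = AllPairs.tail (stack↘ inv)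
    ; input>1         = input>1 inv
    ; unique          = AllPairs.tail (unique inv)
    ; stack-dominates = λ y∈S → stack-dominates inv (there y∈S)
    ; input-213-free  = input-213-free inv
    }

  Sortable-push : ∀ {x s inp S} → s < x → Sortable (x ∷ inp) (s ∷ S) → Sortable inp (x ∷ s ∷ S)
  Sortable-push {x} {s} {inp} {S} s<x inv = record
    { stack↘          = (s<x ∷ All.map (λ t<s → <-trans t<s s<x) (AllPairs.head (stack↘ inv))) ∷ stack↘ inv
    ; input>1         = All.tail (input>1 inv)
    ; unique          = Unique-resp-↭ (shift x (s ∷ S) inp) (unique inv)
    ; stack-dominates = dominates
    ; input-213-free  = λ xyz⊆inp → input-213-free inv (x ∷ʳ xyz⊆inp)
    }
    where
    dominates : ∀ {y x′ z} → y ∈ x ∷ s ∷ S → (x′ ∷ z ∷ []) ⊆ inp → x′ < y → z < y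
    dominates (here refl) x′z⊆inp = input-213-free inv (refl ∷ x′z⊆inp)
    dominates (there y∈S) x′z⊆inp = stack-dominates inv y∈S (x ∷ʳ x′z⊆inp)

  DecreasingRun : List ℕ → List ℕ → Set
  DecreasingRun inp S = ∃ λ out → Run T inp (S ++ 1 ∷ []) out × Decreasing out

  DecreasingRun-∷ : ∀ {x inp} S → Sortable (x ∷ inp) S →
                    (∀ S′ → Sortable inp S′ → DecreasingRun inp S′) → DecreasingRun (x ∷ inp) S
  DecreasingRun-∷ [] inv runRest =
    let out , run , out↘ = runRest _ (Sortable-pushOnto1 inv)
    in out , push pushable₂ run , out↘
  DecreasingRun-∷ {x} {inp} (s ∷ S) inv runRest with <-cmp x s
  ... | tri≈ _ refl _ = ⊥-elim (All.lookup (AllPairs.head (unique inv)) (∈-++⁺ʳ S (here refl)) refl)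
  ... | tri> _ _ s<x =
    let out , run , out↘ = runRest _ (Sortable-push s<x inv)
    in out , push (decreasing⇒AvoidsAll _ (stack↘ (Sortable-push s<x inv))) run , out↘
  ... | tri< x<s _ _ =
    let out , run , out↘ = DecreasingRun-∷ S (Sortable-pop inv) runRest
    in s ∷ out ,
       pop (contains231⇒¬AvoidsAll (refl ∷ refl ∷ from∈ (∈-++⁺ʳ S (here refl))) (All.head (input>1 inv)) x<s) run ,
       All.tabulate (below-s run) ∷ out↘
    where
    below-s : ∀ {out} → Run T (x ∷ inp) (S ++ 1 ∷ []) out → ∀ {z} → z ∈ out → z < s
    below-s run z∈out with ∈-++⁻ (x ∷ inp) (∈-resp-↭ (Run-↭ run) z∈out)
    ... | inj₁ (here refl)   = x<s
    ... | inj₁ (there z∈inp) = stack-dominates inv (here refl) (refl ∷ from∈ z∈inp) x<s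
    ... | inj₂ z∈S1          = All.lookup (AllPairs.head (stack↘ inv)) z∈S1

  Sortable⇒DecreasingRun : ∀ inp S → Sortable inp S → DecreasingRun inp S
  Sortable⇒DecreasingRun []        S inv = S ++ 1 ∷ [] , Run-popAll _ , stack↘ inv
  Sortable⇒DecreasingRun (x ∷ inp) S inv = DecreasingRun-∷ S inv (Sortable⇒DecreasingRun inp)

  Sortable-start : ∀ n ρ → IsPerm n (1 ∷ ρ) → Avoids ρ p213 → Sortable ρ []
  Sortable-start n ρ perm ρ-avoids = record
    { stack↘          = [] ∷ []
    ; input>1         = All.zipWith (uncurry ≤∧≢⇒<) (All.tail positive , AllPairs.head 1∷ρ-unique)
    ; unique          = AllPairs.tail 1∷ρ-unique
    ; stack-dominates = λ ()
    ; input-213-free  = no213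
    }
    where
    1∷ρ-unique : Unique (1 ∷ ρ)
    1∷ρ-unique = Unique-resp-↭ (↭-sym perm) (identity-unique n)
    positive : All (1 ≤_) (1 ∷ ρ)
    positive = All-resp-↭ (↭-sym perm) (identity-positive n)
    no213 : ∀ {x y z} → (x ∷ y ∷ z ∷ []) ⊆ ρ → y < x → z < x
    no213 {x} {y} {z} xyz⊆ρ y<x with <-cmp z x
    ... | tri< z<x _ _ = z<x
    ... | tri≈ _ refl _ = ⊥-elim (All.lookup (AllPairs.head (AllPairs-resp-⊆ xyz⊆ρ (AllPairs.tail 1∷ρ-unique)))
                                             (there (here refl)) refl)
    ... | tri> _ _ x<z = ⊥-elim (ρ-avoids (_ , xyz⊆ρ , OrderIso-213 y<x x<z))

  startsWith1-avoider⇒sortsToRev : ∀ n π → IsPerm n π → (∃ λ ρ → π ≡ 1 ∷ ρ × Avoids ρ p213) →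
                                   SortsTo T π (revIdentity n)
  startsWith1-avoider⇒sortsToRev n _ perm (ρ , refl , ρ-avoids) = subst (SortsTo T (1 ∷ ρ)) out≡rev sorting
    where
    decreasingRun : DecreasingRun ρ []
    decreasingRun = Sortable⇒DecreasingRun ρ [] (Sortable-start n ρ perm ρ-avoids)
    sorting : SortsTo T (1 ∷ ρ) (proj₁ decreasingRun)
    sorting = push pushable₁ (proj₁ (proj₂ decreasingRun))
    out↭rev : proj₁ decreasingRun ↭ revIdentity n
    out↭rev = ↭-trans (Run-↭ sorting)
                (subst (_↭ revIdentity n) (sym (++-identityʳ (1 ∷ ρ))) (↭-trans perm (↭-sym (revIdentity↭identity n))))
    out≡rev : proj₁ decreasingRun ≡ revIdentity n
    out≡rev = Decreasing-↭⇒≡ (proj₂ (proj₂ decreasingRun)) (revIdentity-decreasing n) out↭rev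

  sortsToRev⇔startsWith1-avoider : ∀ m π → IsPerm (suc m) π →
                                   SortsTo T π (revIdentity (suc m)) ⇔ (∃ λ ρ → π ≡ 1 ∷ ρ × Avoids ρ p213)
  sortsToRev⇔startsWith1-avoider m π perm = mk⇔ sortsToRev⇒startsWith1-avoider
                                                 (startsWith1-avoider⇒sortsToRev (suc m) π perm)
    where
    sortsToRev⇒startsWith1-avoider : SortsTo T π (revIdentity (suc m)) → ∃ λ ρ → π ≡ 1 ∷ ρ × Avoids ρ p213
    sortsToRev⇒startsWith1-avoider sorting with sortsToRev⇒startsWith1 m sorting
    ... | ρ , π≡1∷ρ , run = ρ , π≡1∷ρ , Run-decreasing⇒Avoids213 run (revIdentity-decreasing (suc m))

  record Consistent (c : Config) (u h : ℕ) : Set where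
    field
      stack↘     : Decreasing (stack c ++ 1 ∷ [])
      stack≤     : All (_≤ pending c) (stack c)
      input∈     : All (λ x → 1 < x × x ≤ pending c) (input c)
      height     : length (stack c) ≡ h
      pending≡   : pending c ≡ suc (u + h)
      sortsToRev : Run T (input c) (stack c ++ 1 ∷ []) (revIdentity (pending c))

  open Consistent

  Consistent-undoPop : ∀ {c u h} → Consistent c u h → Consistent (replayStep false c) u (suc h)
  Consistent-undoPop {config I S k} {u} {h} con = record
    { stack↘     = All.++⁺ (All.map s≤s (stack≤ con)) (s≤s 1≤k ∷ []) ∷ stack↘ con
    ; stack≤     = ≤-refl ∷ All.map m≤n⇒m≤1+n (stack≤ con)
    ; input∈     = All.map (λ (1<x , x≤k) → 1<x , m≤n⇒m≤1+n x≤k) (input∈ con)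
    ; height     = cong suc (height con)
    ; pending≡   = cong suc (trans (pending≡ con) (sym (+-suc u h)))
    ; sortsToRev = pop (blocked I (input∈ con)) (sortsToRev con)
    }
    where
    1≤k : 1 ≤ k
    1≤k = subst (1 ≤_) (sym (pending≡ con)) (s≤s z≤n)
    blocked : ∀ I → All (λ x → 1 < x × x ≤ k) I → ¬ CanPush T I (suc k ∷ S ++ 1 ∷ [])
    blocked []      _                  ()
    blocked (x ∷ I) ((1<x , x≤k) ∷ _) =
      contains231⇒¬AvoidsAll (refl ∷ refl ∷ from∈ (∈-++⁺ʳ S (here refl))) 1<x (s≤s x≤k)

  Consistent-undoPush : ∀ {c u h} → Consistent c u (suc h) → Consistent (replayStep true c) (suc u) h
  Consistent-undoPush {config I (s ∷ S) k} {u} {h} con = record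
    { stack↘     = AllPairs.tail (stack↘ con)
    ; stack≤     = All.tail (stack≤ con)
    ; input∈     = (All.lookup (AllPairs.head (stack↘ con)) (∈-++⁺ʳ S (here refl)) , All.head (stack≤ con))
                   ∷ input∈ con
    ; height     = suc-injective (height con)
    ; pending≡   = trans (pending≡ con) (cong suc (+-suc u h))
    ; sortsToRev = push (decreasing⇒AvoidsAll _ (stack↘ con)) (sortsToRev con)
    }

  Admissible⇒Consistent : ∀ {u h w} → Admissible u h w → Consistent (replay w) u h
  Admissible⇒Consistent end = record
    { stack↘ = [] ∷ [] ; stack≤ = [] ; input∈ = [] ; height = refl ; pending≡ = refl
    ; sortsToRev = pop (λ ()) done }
  Admissible⇒Consistent (up a)   = Consistent-undoPush (Admissible⇒Consistent a)
  Admissible⇒Consistent (down a) = Consistent-undoPop (Admissible⇒Consistent a)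

  Run⇒replay : ∀ S {I stk out k} → Run T I stk out → stk ≡ S ++ 1 ∷ [] → out ≡ revIdentity k →
               ∃ λ w → Admissible (length I) (length S) w × replay w ≡ config I S k
  Run⇒replay []      done ()
  Run⇒replay (_ ∷ _) done ()
  Run⇒replay S (push {x} _ run) stk≡ out≡ with Run⇒replay (x ∷ S) run (cong (x ∷_) stk≡) out≡
  ... | w , a , replay≡ = true ∷ w , up a , cong (replayStep true) replay≡
  Run⇒replay [] {k = 1} (pop {[]} _ run) refl out≡ with Run-finished run
  ... | refl = [] , end , refl
  Run⇒replay [] {k = 0}           (pop {[]} _ _) refl ()
  Run⇒replay [] {k = suc (suc _)} (pop {[]} _ _) refl ()
  Run⇒replay [] (pop {_ ∷ _} ¬pushable _) refl _ = ⊥-elim (¬pushable pushable₂)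
  Run⇒replay (s ∷ S) {k = zero} (pop _ _) refl ()
  Run⇒replay (s ∷ S) {k = suc k} (pop _ run) refl out≡ with ∷-injective out≡
  ... | refl , out≡′ with Run⇒replay S run refl out≡′
  ...   | w , a , replay≡ = false ∷ w , down a , cong (replayStep false) replay≡

  start≢undoPush : ∀ {c u h} → Consistent c u (suc h) → replay [] ≢ replayStep true c
  start≢undoPush {config I (s ∷ S) k} _ ()

  undoPop≢undoPush : ∀ {c c′ u h} → Consistent c′ u (suc h) → replayStep false c ≢ replayStep true c′
  undoPop≢undoPush {config I S k} {config I′ (s ∷ .(suc k ∷ S)) .(suc k)} con refl =
    <-irrefl refl (<-≤-trans (All.head (AllPairs.head (stack↘ con))) (All.head (stack≤ con)))

  undoPop-injective : ∀ c c′ → replayStep false c ≡ replayStep false c′ → c ≡ c′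
  undoPop-injective (config I S k) (config .I .S .k) refl = refl

  undoPush-injective : ∀ {c c′ u h u′ h′} → Consistent c u (suc h) → Consistent c′ u′ (suc h′) →
                       replayStep true c ≡ replayStep true c′ → c ≡ c′
  undoPush-injective {config I (s ∷ S) k} {config .I (.s ∷ .S) .k} _ _ refl = refl

  replay-injective : ∀ {u₁ h₁ w₁ u₂ h₂ w₂} → Admissible u₁ h₁ w₁ → Admissible u₂ h₂ w₂ →
                     replay w₁ ≡ replay w₂ → w₁ ≡ w₂
  replay-injective end      end      _  = refl
  replay-injective end      (down _) ()
  replay-injective (down _) end      ()
  replay-injective end      (up b)   eq = ⊥-elim (start≢undoPush (Admissible⇒Consistent b) eq)
  replay-injective (up a)   end      eq = ⊥-elim (start≢undoPush (Admissible⇒Consistent a) (sym eq))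
  replay-injective (down _) (up b)   eq = ⊥-elim (undoPop≢undoPush (Admissible⇒Consistent b) eq)
  replay-injective (up a)   (down _) eq = ⊥-elim (undoPop≢undoPush (Admissible⇒Consistent a) (sym eq))
  replay-injective (down a) (down b) eq = cong (false ∷_) (replay-injective a b (undoPop-injective _ _ eq))
  replay-injective (up a)   (up b)   eq =
    cong (true ∷_) (replay-injective a b
      (undoPush-injective (Admissible⇒Consistent a) (Admissible⇒Consistent b) eq))

  Consistent⇒sortsToRev : ∀ {c m} → Consistent c m 0 → SortsTo T (1 ∷ input c) (revIdentity (suc m))
  Consistent⇒sortsToRev {config I [] k} {m} con =
    subst (λ n → SortsTo T (1 ∷ I) (revIdentity n)) (trans (pending≡ con) (cong suc (+-identityʳ m)))
          (push pushable₁ (sortsToRev con))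

  Consistent-input-injective : ∀ {c c′ m} → Consistent c m 0 → Consistent c′ m 0 → input c ≡ input c′ → c ≡ c′
  Consistent-input-injective {config I [] k} {config .I [] k′} con con′ refl =
    cong (config I []) (trans (pending≡ con) (sym (pending≡ con′)))

  ∈-sortedPermutations : ∀ m π → π ∈ sortedPermutations m ⇔ (IsPerm (suc m) π × SortsTo T π (revIdentity (suc m)))
  ∈-sortedPermutations m π = mk⇔ sorted complete
    where
    sorted : π ∈ sortedPermutations m → IsPerm (suc m) π × SortsTo T π (revIdentity (suc m))
    sorted π∈ with ∈-map⁻ _ π∈
    ... | w , w∈ , refl = sortsToRev⇒IsPerm run , run
      where run = Consistent⇒sortsToRev (Admissible⇒Consistent (∈-admissibleWords⁻ m 0 w∈))
    complete : IsPerm (suc m) π × SortsTo T π (revIdentity (suc m)) → π ∈ sortedPermutations m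
    complete (perm , sorting) with sortsToRev⇒startsWith1 m sorting
    ... | ρ , refl , run with Run⇒replay [] run refl refl
    ...   | w , a , replay≡ =
      subst (_∈ sortedPermutations m) (cong (λ c → 1 ∷ input c) replay≡) (∈-map⁺ _ (∈-admissibleWords⁺ a′))
      where
      |ρ|≡m : length ρ ≡ m
      |ρ|≡m = suc-injective (trans (↭-length perm) (length-identity (suc m)))
      a′ : Admissible m 0 w
      a′ = subst (λ u → Admissible u 0 w) |ρ|≡m a

  sortedPermutations-unique : ∀ m → Unique (sortedPermutations m)
  sortedPermutations-unique m = Unique-map⁺-injectiveOn _ injective (admissibleWords-unique m 0)
    where
    injective : ∀ {w w′} → w ∈ admissibleWords m 0 → w′ ∈ admissibleWords m 0 →
                1 ∷ input (replay w) ≡ 1 ∷ input (replay w′) → w ≡ w′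
    injective w∈ w′∈ eq = replay-injective a a′
      (Consistent-input-injective (Admissible⇒Consistent a) (Admissible⇒Consistent a′) (∷-injectiveʳ eq))
      where
      a = ∈-admissibleWords⁻ m 0 w∈
      a′ = ∈-admissibleWords⁻ m 0 w′∈

corollary3p2 : (τ : List ℕ) → IsPerm (length τ) τ → 3 ≤ length τ → τ ≢ revIdentity (length τ) →
    (n : ℕ) → 1 ≤ n →
    (∃ λ (L : List (List ℕ)) → Unique L × length L ≡ catalan (n ∸ 1) ×
       (∀ π → (π ∈ L) ⇔ (IsPerm n π × SortsTo (p231 ∷ τ ∷ []) π (revIdentity n))))
    × (∀ π → IsPerm n π →
       (SortsTo (p231 ∷ τ ∷ []) π (revIdentity n) ⇔ (∃ λ ρ → π ≡ 1 ∷ ρ × Avoids ρ p213)))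
corollary3p2 τ τ-perm 3≤|τ| τ≢rev (suc m) _ =
  (sortedPermutations m , sortedPermutations-unique m , length-sortedPermutations m , ∈-sortedPermutations m) ,
  sortsToRev⇔startsWith1-avoider m
  where open SortBy231And τ τ-perm 3≤|τ| τ≢rev
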